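{- Let $k,n$ be integers with $3\leq k\leq n$, and let $K_n$ be the complete graph of order $n$. Then $\mu_k(K_n)=n-k$.
   Context: For a graph $G$ and $S\subseteq V(G)$ with $|S|\geq 2$, a pendant $S$-Steiner tree is a subgraph of $G$ that is a tree whose vertex set contains $S$ and in which every vertex of $S$ has degree exactly $1$. $\mu_G(S)$ is the maximum number of pairwise edge-disjoint pendant $S$-Steiner trees in $G$, and for $2\leq k\leq |V(G)|$, $\mu_k(G)=\min\{\mu_G(S): S\subseteq V(G),|S|=k\}$. -}

module Defs where

open import Data.Nat using (ℕ; zero; suc; _+_; _≤_)
open import Data.Fin using (Fin; zero; suc; inject₁; fromℕ; _≟_)
open import Data.Fin.Subset using (Subset; _∈_; _⊆_; ∣_∣)
open import Data.Bool using (Bool; true; false; not; if_then_else_)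
open import Data.List using (List; map; allFin)
open import Data.Nat.ListAction using (sum)
open import Data.Product using (Σ; ∃; _×_; _,_)
open import Relation.Nullary using (¬_)
open import Relation.Nullary.Decidable using (⌊_⌋)
open import Relation.Binary.PropositionalEquality using (_≡_; _≢_)
open import Function.Definitions using (Injective)

record Graph (n : ℕ) : Set where
  field
    adj   : Fin n → Fin n → Bool
    adj-sym : ∀ u v → adj u v ≡ adj v u
    adj-irr : ∀ v → adj v v ≡ false
open Graph public

K : (n : ℕ) → Graph n
K n = record
  { adj    = λ u v → not ⌊ u ≟ v ⌋
  ; adj-sym = symK
  ; adj-irr = irreflK
  }
  where
  open import Relation.Binary.PropositionalEquality using (refl; sym)
  open import Relation.Nullary using (yes; no)
  symK : ∀ u v → not ⌊ u ≟ v ⌋ ≡ not ⌊ v ≟ u ⌋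
  symK u v with u ≟ v | v ≟ u
  ... | yes _ | yes _ = refl
  ... | no _  | no _  = refl
  ... | yes p | no q  = Data.Empty.⊥-elim (q (sym p)) where import Data.Empty
  ... | no p  | yes q = Data.Empty.⊥-elim (p (sym q)) where import Data.Empty
  irreflK : ∀ v → not ⌊ v ≟ v ⌋ ≡ false
  irreflK v with v ≟ v
  ... | yes _ = refl
  ... | no p  = Data.Empty.⊥-elim (p refl) where import Data.Empty

record Subgraph {n : ℕ} (G : Graph n) : Set where
  field
    vs      : Subset n
    es      : Fin n → Fin n → Bool
    es-sym  : ∀ u v → es u v ≡ es v u
    es-irr  : ∀ v → es v v ≡ false
    es-inG  : ∀ u v → es u v ≡ true → adj G u v ≡ true
    es-inV  : ∀ u v → es u v ≡ true → (u ∈ vs × v ∈ vs)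
open Subgraph public

data Walk {n : ℕ} (E : Fin n → Fin n → Bool) : Fin n → Fin n → Set where
  here : ∀ {v} → Walk E v v
  step : ∀ {u w v} → E u w ≡ true → Walk E w v → Walk E u v

Connected : ∀ {n} {G : Graph n} → Subgraph G → Set
Connected H = ∀ u v → u ∈ vs H → v ∈ vs H → Walk (es H) u v

-- A cycle of length m+3: distinct vertices c 0, …, c (m+2) with
-- consecutive ones adjacent and c (m+2) adjacent to c 0.
record Cycle {n : ℕ} (E : Fin n → Fin n → Bool) : Set where
  field
    len   : ℕ
    c     : Fin (suc (suc (suc len))) → Fin n
    inj   : Injective _≡_ _≡_ c
    cons  : ∀ (i : Fin (suc (suc len))) → E (c (inject₁ i)) (c (suc i)) ≡ true
    close : E (c (fromℕ (suc (suc len)))) (c zero) ≡ true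

Acyclic : ∀ {n} {G : Graph n} → Subgraph G → Set
Acyclic H = ¬ Cycle (es H)

IsTree : ∀ {n} {G : Graph n} → Subgraph G → Set
IsTree H = Connected H × Acyclic H

deg : ∀ {n} {G : Graph n} → Subgraph G → Fin n → ℕ
deg H v = sum (map (λ w → if es H v w then 1 else 0) (allFin _))

record PendantSteinerTree {n : ℕ} (G : Graph n) (S : Subset n) : Set where
  field
    tree    : Subgraph G
    isTree  : IsTree tree
    S⊆V     : S ⊆ vs tree
    pendant : ∀ v → v ∈ S → deg tree v ≡ 1
open PendantSteinerTree public

HasDisjointPendantTrees : ∀ {n} (G : Graph n) (S : Subset n) (m : ℕ) → Set
HasDisjointPendantTrees G S m =
  Σ (Fin m → PendantSteinerTree G S) λ T →
    ∀ i j → i ≢ j → ∀ u v →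
      ¬ (es (tree (T i)) u v ≡ true × es (tree (T j)) u v ≡ true)

IsMu : ∀ {n} (G : Graph n) (S : Subset n) (m : ℕ) → Set
IsMu G S m = HasDisjointPendantTrees G S m
           × (∀ m' → HasDisjointPendantTrees G S m' → m' ≤ m)

IsMuK : ∀ {n} (G : Graph n) (k m : ℕ) → Set
IsMuK {n} G k m =
  (∀ (S : Subset n) → ∣ S ∣ ≡ k → ∃ λ m' → IsMu G S m' × m ≤ m')
  × (∃ λ (S : Subset n) → ∣ S ∣ ≡ k × IsMu G S m)

-- In K_n every S with |S| ≥ 3 has μ(S) = |V ∖ S|.  Each c ∉ S is the centre of
-- the star joining c to all of S, a pendant S-Steiner tree, and stars with different
-- centres share no edge.  Conversely, fix a ∈ S: in a pendant S-Steiner tree a has a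
-- unique neighbour w, and w ∉ S, for otherwise a and w would both have degree 1 and
-- the edge aw would be a whole component, missing a third vertex of S.  Edge-disjoint
-- trees give distinct neighbours w, so there are at most |V ∖ S| of them.
module Submission where

open import Defs
open import Data.Nat using (ℕ; zero; suc; _≤_; _∸_; z≤n; s≤s)
open import Data.Nat.Properties using (suc-injective; ≤-refl)
open import Data.Fin using (Fin; zero; suc; _≟_)
open import Data.Fin.Properties using (0≢1+n; injective⇒≤)
  renaming (suc-injective to fsuc-injective)
open import Data.Bool using (Bool; true; false; if_then_else_; _∧_; _∨_; T)
open import Data.Bool.Properties using (T-≡; T-∧; T-∨; ∨-comm; ¬-not)
open import Data.List using (tabulate)
open import Data.List.Properties using (map-tabulate)
open import Data.Nat.ListAction using (sum)
open import Data.Vec using (_∷_; here; there)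
open import Data.Fin.Subset using (Subset; _∈_; _∉_; _⊆_; ∣_∣; ⊥; inside; outside; ∁; _∪_; ⁅_⁆)
open import Data.Fin.Subset.Properties
  using (_∈?_; ∣⊥∣≡0; x∈⁅x⁆; x∈⁅y⁆⇒x≡y; x∈p∪q⁺; x∈p∪q⁻; x∉p⇒x∈∁p; x∈∁p⇒x∉p; ∣∁p∣≡n∸∣p∣)
open import Data.Product using (∃; Σ-syntax; _×_; _,_; proj₁; proj₂)
open import Data.Sum using (_⊎_; inj₁; inj₂; [_,_])
import Data.Sum as Sum
import Data.Product as Product
open import Data.Empty using (⊥-elim)
open import Function using (_∘_; id)
open import Function.Bundles using (Equivalence)
open import Function.Definitions using (Injective)
open import Relation.Nullary using (¬_; Dec; yes; no)
open import Relation.Nullary.Decidable using (⌊_⌋; toWitness; fromWitness)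
open import Relation.Binary.PropositionalEquality using (_≡_; _≢_; refl; sym; trans; cong; subst)

count : ∀ {n} → (Fin n → Bool) → ℕ
count b = sum (tabulate (λ w → if b w then 1 else 0))

deg≡count : ∀ {n} {G : Graph n} (H : Subgraph G) v → deg H v ≡ count (es H v)
deg≡count H v = cong sum (map-tabulate id (λ w → if es H v w then 1 else 0))

count≡0⇒false : ∀ {n} (b : Fin n → Bool) → count b ≡ 0 → ∀ x → b x ≡ false
count≡0⇒false {suc n} b e x with b zero in b₀
count≡0⇒false         b ()  x       | true
count≡0⇒false         b e   zero    | false = b₀
count≡0⇒false         b e   (suc x) | false = count≡0⇒false (b ∘ suc) e x

count-false≡0 : ∀ {n} (b : Fin n → Bool) → (∀ x → b x ≡ false) → count b ≡ 0
count-false≡0 {zero}  b f = refl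
count-false≡0 {suc n} b f rewrite f zero = count-false≡0 (b ∘ suc) (f ∘ suc)

count≡1⇒∃! : ∀ {n} (b : Fin n → Bool) → count b ≡ 1 →
             ∃ λ w → b w ≡ true × ∀ x → b x ≡ true → x ≡ w
count≡1⇒∃! {suc n} b e with b zero in b₀
... | true = zero , b₀ , unique
  where
  unique : ∀ x → b x ≡ true → x ≡ zero
  unique zero    _  = refl
  unique (suc x) bx with () ← trans (sym bx) (count≡0⇒false (b ∘ suc) (suc-injective e) x)
... | false with count≡1⇒∃! (b ∘ suc) e
...   | w , bw , uniqueʷ = suc w , bw , unique
  where
  unique : ∀ x → b x ≡ true → x ≡ suc w
  unique zero    bx with () ← trans (sym bx) b₀
  unique (suc x) bx = cong suc (uniqueʷ x bx)

∃!⇒count≡1 : ∀ {n} (b : Fin n → Bool) (w : Fin n) →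
             b w ≡ true → (∀ x → b x ≡ true → x ≡ w) → count b ≡ 1
∃!⇒count≡1 b zero bw unique rewrite bw =
  cong suc (count-false≡0 (b ∘ suc) λ x → ¬-not (0≢1+n ∘ sym ∘ unique (suc x)))
∃!⇒count≡1 b (suc w) bw unique with b zero in b₀
... | true  with () ← unique zero b₀
... | false = ∃!⇒count≡1 (b ∘ suc) w bw (λ x bx → fsuc-injective (unique (suc x) bx))

_++ʷ_ : ∀ {n} {E : Fin n → Fin n → Bool} {u v w} → Walk E u v → Walk E v w → Walk E u w
here      ++ʷ q = q
step e p ++ʷ q = step e (p ++ʷ q)

walk-preserves : ∀ {n} {E : Fin n → Fin n → Bool} (P : Fin n → Set) →
                 (∀ {u v} → E u v ≡ true → P u → P v) →
                 ∀ {u v} → Walk E u v → P u → P v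
walk-preserves P closed here       Pu = Pu
walk-preserves P closed (step e p) Pu = walk-preserves P closed p (closed e Pu)

edge-leaving-third : ∀ {n} {E : Fin n → Fin n → Bool} (C : Cycle E) → let open Cycle C in
                     ∃ λ j → suc zero ≢ j × E (c (suc (suc zero))) (c j) ≡ true
edge-leaving-third record { len = zero  ; close = close } = zero , (λ ()) , close
edge-leaving-third record { len = suc _ ; cons = cons }   = suc (suc (suc zero)) , (λ ()) , cons (suc (suc zero))

module _ {n} {E : Fin n → Fin n → Bool} (c : Fin n)
         (hub : ∀ {u v} → E u v ≡ true → u ≡ c ⊎ v ≡ c) where

  middle≡hub : ∀ {x y z} → E x y ≡ true → E y z ≡ true → x ≢ z → y ≡ c
  middle≡hub exy eyz x≢z with hub exy | hub eyz
  ... | inj₂ y≡c | _        = y≡c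
  ... | inj₁ _   | inj₁ y≡c = y≡c
  ... | inj₁ x≡c | inj₂ z≡c = ⊥-elim (x≢z (trans x≡c (sym z≡c)))

  common-endpoint⇒¬Cycle : ¬ Cycle E
  common-endpoint⇒¬Cycle C with edge-leaving-third C
  ... | j , 1≢j , e₂ⱼ = distinct (λ ()) (trans v₁≡c (sym v₂≡c))
    where
    open Cycle C renaming (c to v)
    distinct : ∀ {i j} → i ≢ j → v i ≢ v j
    distinct i≢j = i≢j ∘ inj
    v₁≡c : v (suc zero) ≡ c
    v₁≡c = middle≡hub (cons zero) (cons (suc zero)) (distinct λ ())
    v₂≡c : v (suc (suc zero)) ≡ c
    v₂≡c = middle≡hub (cons (suc zero)) e₂ⱼ (distinct 1≢j)

select : ∀ {n} (p : Subset n) → Fin ∣ p ∣ → Fin n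
select (inside  ∷ p) zero    = zero
select (inside  ∷ p) (suc i) = suc (select p i)
select (outside ∷ p) i       = suc (select p i)

select-∈ : ∀ {n} (p : Subset n) i → select p i ∈ p
select-∈ (inside  ∷ p) zero    = here
select-∈ (inside  ∷ p) (suc i) = there (select-∈ p i)
select-∈ (outside ∷ p) i       = there (select-∈ p i)

select-injective : ∀ {n} (p : Subset n) → Injective _≡_ _≡_ (select p)
select-injective (inside  ∷ p) {zero}  {zero}  _ = refl
select-injective (inside  ∷ p) {suc i} {suc j} e = cong suc (select-injective p (fsuc-injective e))
select-injective (outside ∷ p)                  e = select-injective p (fsuc-injective e)

rank : ∀ {n} {p : Subset n} {x} → x ∈ p → Fin ∣ p ∣
rank {p = inside  ∷ p} here        = zero
rank {p = inside  ∷ p} (there x∈p) = suc (rank x∈p)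
rank {p = outside ∷ p} (there x∈p) = rank x∈p

rank-injective : ∀ {n} {p : Subset n} {x y} (x∈p : x ∈ p) (y∈p : y ∈ p) → rank x∈p ≡ rank y∈p → x ≡ y
rank-injective {p = inside  ∷ p} here        here        _ = refl
rank-injective {p = inside  ∷ p} (there x∈p) (there y∈p) e = cong suc (rank-injective x∈p y∈p (fsuc-injective e))
rank-injective {p = outside ∷ p} (there x∈p) (there y∈p) e = cong suc (rank-injective x∈p y∈p e)

injective-into⇒≤∣_∣ : ∀ {m n} (p : Subset n) {f : Fin m → Fin n} →
                      Injective _≡_ _≡_ f → (∀ i → f i ∈ p) → m ≤ ∣ p ∣
injective-into⇒≤∣ p ∣ f-inj f∈p = injective⇒≤ (f-inj ∘ rank-injective (f∈p _) (f∈p _))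

∃-subset-of-size : ∀ {k n} → k ≤ n → ∃ λ (p : Subset n) → ∣ p ∣ ≡ k
∃-subset-of-size {n = n} z≤n = ⊥ , ∣⊥∣≡0 n
∃-subset-of-size (s≤s k≤n) with p , ∣p∣≡k ← ∃-subset-of-size k≤n = inside ∷ p , cong suc ∣p∣≡k

module _ {n} (p : Subset n) where

  ∃-element-avoiding-two : 3 ≤ ∣ p ∣ →
    Σ[ a ∈ Fin n ] a ∈ p × (∀ w → Σ[ t ∈ Fin n ] t ∈ p × t ≢ a × t ≢ w)
  ∃-element-avoiding-two = go (select p) (select-injective p) (select-∈ p)
    where
    go : ∀ {m} (f : Fin m → Fin n) → Injective _≡_ _≡_ f → (∀ i → f i ∈ p) → 3 ≤ m →
         Σ[ a ∈ Fin n ] a ∈ p × (∀ w → Σ[ t ∈ Fin n ] t ∈ p × t ≢ a × t ≢ w)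
    go f f-inj f∈p (s≤s (s≤s (s≤s _))) = f zero , f∈p zero , avoid
      where
      avoid : ∀ w → Σ[ t ∈ Fin n ] t ∈ p × t ≢ f zero × t ≢ w
      avoid w with f (suc zero) ≟ w
      ... | no  f₁≢w = f (suc zero) , f∈p _ , (λ ()) ∘ f-inj , f₁≢w
      ... | yes f₁≡w = f (suc (suc zero)) , f∈p _ , (λ ()) ∘ f-inj , (λ ()) ∘ f-inj ∘ (λ e → trans e (sym f₁≡w))

module _ {A B : Set} {a? : Dec A} {b? : Dec B} where

  T-∧-witnesses : T (⌊ a? ⌋ ∧ ⌊ b? ⌋) → A × B
  T-∧-witnesses t = Product.map (toWitness {a? = a?}) (toWitness {a? = b?}) (Equivalence.to T-∧ t)

  witnesses-T-∧ : A × B → T (⌊ a? ⌋ ∧ ⌊ b? ⌋)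
  witnesses-T-∧ (a , b) = Equivalence.from (T-∧ {⌊ a? ⌋}) (fromWitness a , fromWitness b)

-- Abstract so that an edge proof determines c, S, u, v; the relation is used
-- only through star-sym and star-edge⁻/⁺.
abstract

  star : ∀ {n} → Fin n → Subset n → Fin n → Fin n → Bool
  star c S u v = (⌊ u ≟ c ⌋ ∧ ⌊ v ∈? S ⌋) ∨ (⌊ v ≟ c ⌋ ∧ ⌊ u ∈? S ⌋)

  star-sym : ∀ {n} (c : Fin n) (S : Subset n) u v → star c S u v ≡ star c S v u
  star-sym c S u v = ∨-comm (⌊ u ≟ c ⌋ ∧ ⌊ v ∈? S ⌋) (⌊ v ≟ c ⌋ ∧ ⌊ u ∈? S ⌋)

  star-edge⁻ : ∀ {n} {c : Fin n} {S u v} → star c S u v ≡ true → (u ≡ c × v ∈ S) ⊎ (v ≡ c × u ∈ S)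
  star-edge⁻ {c = c} {u = u} {v} e =
    Sum.map (T-∧-witnesses {a? = u ≟ c}) (T-∧-witnesses {a? = v ≟ c})
            (Equivalence.to T-∨ (Equivalence.from T-≡ e))

  star-edge⁺ : ∀ {n} {c : Fin n} {S u v} → (u ≡ c × v ∈ S) ⊎ (v ≡ c × u ∈ S) → star c S u v ≡ true
  star-edge⁺ {c = c} {u = u} {v} e =
    Equivalence.to T-≡ (Equivalence.from T-∨
      (Sum.map (witnesses-T-∧ {a? = u ≟ c}) (witnesses-T-∧ {a? = v ≟ c}) e))

star-centre-unique : ∀ {n} {S : Subset n} {c c′ u v : Fin n} → c ∉ S →
                     star c S u v ≡ true → star c′ S u v ≡ true → c ≡ c′
star-centre-unique c∉S e e′ with star-edge⁻ e | star-edge⁻ e′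
... | inj₁ (u≡c , _)   | inj₁ (u≡c′ , _)  = trans (sym u≡c) u≡c′
... | inj₂ (v≡c , _)   | inj₂ (v≡c′ , _)  = trans (sym v≡c) v≡c′
... | inj₁ (refl , _)  | inj₂ (_ , c∈S)   = ⊥-elim (c∉S c∈S)
... | inj₂ (refl , _)  | inj₁ (_ , c∈S)   = ⊥-elim (c∉S c∈S)

module Star {n} (G : Graph n) (S : Subset n) (c : Fin n) (c∉S : c ∉ S)
            (c-adj : ∀ {s} → s ∈ S → adj G c s ≡ true) where

  E : Fin n → Fin n → Bool
  E = star c S

  V : Subset n
  V = S ∪ ⁅ c ⁆

  c∈V : c ∈ V
  c∈V = x∈p∪q⁺ (inj₂ (x∈⁅x⁆ c))

  S⊆centre+S : S ⊆ V
  S⊆centre+S s∈S = x∈p∪q⁺ (inj₁ s∈S)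

  ∈S⇒≢c : ∀ {s} → s ∈ S → s ≢ c
  ∈S⇒≢c s∈S refl = c∉S s∈S

  E-irr : ∀ v → E v v ≡ false
  E-irr v = ¬-not λ e → [ loop , loop ] (star-edge⁻ e)
    where
    loop : ¬ (v ≡ c × v ∈ S)
    loop (v≡c , v∈S) = ∈S⇒≢c v∈S v≡c

  E⊆G : ∀ u v → E u v ≡ true → adj G u v ≡ true
  E⊆G u v e with star-edge⁻ e
  ... | inj₁ (refl , v∈S) = c-adj v∈S
  ... | inj₂ (refl , u∈S) = trans (adj-sym G u c) (c-adj u∈S)

  E⊆V : ∀ u v → E u v ≡ true → u ∈ V × v ∈ V
  E⊆V u v e with star-edge⁻ e
  ... | inj₁ (refl , v∈S) = c∈V , S⊆centre+S v∈S
  ... | inj₂ (refl , u∈S) = S⊆centre+S u∈S , c∈V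

  H : Subgraph G
  H = record { vs = V ; es = E ; es-sym = star-sym c S ; es-irr = E-irr ; es-inG = E⊆G ; es-inV = E⊆V }

  to-centre : ∀ {u} → u ∈ V → Walk E u c
  to-centre {u} u∈V with x∈p∪q⁻ S ⁅ c ⁆ u∈V
  ... | inj₁ u∈S = step (star-edge⁺ (inj₂ (refl , u∈S))) here
  ... | inj₂ u∈c with refl ← x∈⁅y⁆⇒x≡y c u∈c = here

  from-centre : ∀ {v} → v ∈ V → Walk E c v
  from-centre {v} v∈V with x∈p∪q⁻ S ⁅ c ⁆ v∈V
  ... | inj₁ v∈S = step (star-edge⁺ (inj₁ (refl , v∈S))) here
  ... | inj₂ v∈c with refl ← x∈⁅y⁆⇒x≡y c v∈c = here

  connected : Connected H
  connected u v u∈V v∈V = to-centre u∈V ++ʷ from-centre v∈V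

  acyclic : Acyclic H
  acyclic = common-endpoint⇒¬Cycle c λ e → Sum.map proj₁ proj₁ (star-edge⁻ e)

  deg-leaf : ∀ {s} → s ∈ S → deg H s ≡ 1
  deg-leaf {s} s∈S = trans (deg≡count H s) (∃!⇒count≡1 (E s) c (star-edge⁺ (inj₂ (refl , s∈S))) only-c)
    where
    only-c : ∀ x → E s x ≡ true → x ≡ c
    only-c x e with star-edge⁻ e
    ... | inj₁ (s≡c , _) = ⊥-elim (∈S⇒≢c s∈S s≡c)
    ... | inj₂ (x≡c , _) = x≡c

  pendantTree : PendantSteinerTree G S
  pendantTree = record { tree = H ; isTree = connected , acyclic ; S⊆V = S⊆centre+S ; pendant = λ _ → deg-leaf }

module _ {n} {G : Graph n} {S : Subset n} (P : PendantSteinerTree G S) where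

  private
    E : Fin n → Fin n → Bool
    E = es (tree P)

  terminal-neighbour : ∀ {a} → a ∈ S → ∃ λ w → E a w ≡ true × ∀ x → E a x ≡ true → x ≡ w
  terminal-neighbour {a} a∈S = count≡1⇒∃! (E a) (trans (sym (deg≡count (tree P) a)) (pendant P a a∈S))

  adjacent-terminals⇒S⊆pair : ∀ {a w} → a ∈ S → w ∈ S → E a w ≡ true →
                              ∀ {t} → t ∈ S → t ≡ a ⊎ t ≡ w
  adjacent-terminals⇒S⊆pair {a} {w} a∈S w∈S eaw t∈S =
    walk-preserves (λ x → x ≡ a ⊎ x ≡ w) closed
      (proj₁ (isTree P) a _ (S⊆V P a∈S) (S⊆V P t∈S)) (inj₁ refl)
    where
    only-neighbour : ∀ {s} → s ∈ S → ∀ {x y} → E s x ≡ true → E s y ≡ true → x ≡ y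
    only-neighbour s∈S esx esy with _ , _ , unique ← terminal-neighbour s∈S =
      trans (unique _ esx) (sym (unique _ esy))
    closed : ∀ {x y} → E x y ≡ true → x ≡ a ⊎ x ≡ w → y ≡ a ⊎ y ≡ w
    closed exy (inj₁ refl) = inj₂ (only-neighbour a∈S exy eaw)
    closed exy (inj₂ refl) = inj₁ (only-neighbour w∈S exy (trans (es-sym (tree P) w a) eaw))

module _ {n} {G : Graph n} {S : Subset n} {a} (a∈S : a ∈ S)
         (avoid : ∀ w → Σ[ t ∈ Fin n ] t ∈ S × t ≢ a × t ≢ w) where

  disjointPendantTrees≤∣∁S∣ : ∀ {m} → HasDisjointPendantTrees G S m → m ≤ ∣ ∁ S ∣
  disjointPendantTrees≤∣∁S∣ {m} (T , disjoint) =
    injective-into⇒≤∣ ∁ S ∣ neighbour-injective (λ i → x∉p⇒x∈∁p (neighbour∉S i))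
    where
    neighbour : Fin m → Fin n
    neighbour i = proj₁ (terminal-neighbour (T i) a∈S)
    edge : ∀ i → es (tree (T i)) a (neighbour i) ≡ true
    edge i = proj₁ (proj₂ (terminal-neighbour (T i) a∈S))
    neighbour∉S : ∀ i → neighbour i ∉ S
    neighbour∉S i w∈S with t , t∈S , t≢a , t≢w ← avoid (neighbour i)
      with adjacent-terminals⇒S⊆pair (T i) a∈S w∈S (edge i) t∈S
    ... | inj₁ t≡a = t≢a t≡a
    ... | inj₂ t≡w = t≢w t≡w
    neighbour-injective : Injective _≡_ _≡_ neighbour
    neighbour-injective {i} {j} wᵢ≡wⱼ with i ≟ j
    ... | yes i≡j = i≡j
    ... | no  i≢j = ⊥-elim (disjoint i j i≢j a (neighbour j)
                             (subst (λ w → es (tree (T i)) a w ≡ true) wᵢ≡wⱼ (edge i) , edge j))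

K-adj : ∀ {n} {u v : Fin n} → u ≢ v → adj (K n) u v ≡ true
K-adj {u = u} {v} u≢v with u ≟ v
... | yes u≡v = ⊥-elim (u≢v u≡v)
... | no  _   = refl

stars-in-K : ∀ {n} (S : Subset n) → HasDisjointPendantTrees (K n) S ∣ ∁ S ∣
stars-in-K {n} S = star-tree , disjoint
  where
  centre : Fin ∣ ∁ S ∣ → Fin n
  centre = select (∁ S)
  centre∉S : ∀ i → centre i ∉ S
  centre∉S i = x∈∁p⇒x∉p (select-∈ (∁ S) i)
  star-tree : Fin ∣ ∁ S ∣ → PendantSteinerTree (K n) S
  star-tree i = Star.pendantTree (K n) S (centre i) (centre∉S i)
                  (λ s∈S → K-adj λ { refl → centre∉S i s∈S })
  disjoint : ∀ i j → i ≢ j → ∀ u v →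
             ¬ (es (tree (star-tree i)) u v ≡ true × es (tree (star-tree j)) u v ≡ true)
  disjoint i j i≢j u v (eᵢ , eⱼ) = i≢j (select-injective (∁ S) (star-centre-unique (centre∉S i) eᵢ eⱼ))

isMu-K : ∀ {n} (S : Subset n) → 3 ≤ ∣ S ∣ → IsMu (K n) S ∣ ∁ S ∣
isMu-K S 3≤∣S∣ with a , a∈S , avoid ← ∃-element-avoiding-two S 3≤∣S∣ =
  stars-in-K S , λ _ → disjointPendantTrees≤∣∁S∣ a∈S avoid

proposition2p2 : ∀ (k n : ℕ) → 3 ≤ k → k ≤ n → IsMuK (K n) k (n ∸ k)
proposition2p2 k n 3≤k k≤n with S₀ , ∣S₀∣≡k ← ∃-subset-of-size k≤n =
  (λ S ∣S∣≡k → n ∸ k , μ S ∣S∣≡k , ≤-refl) , (S₀ , ∣S₀∣≡k , μ S₀ ∣S₀∣≡k)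
  where
  μ : ∀ S → ∣ S ∣ ≡ k → IsMu (K n) S (n ∸ k)
  μ S ∣S∣≡k = subst (IsMu (K n) S) (trans (∣∁p∣≡n∸∣p∣ S) (cong (n ∸_) ∣S∣≡k))
                    (isMu-K S (subst (3 ≤_) (sym ∣S∣≡k) 3≤k))
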